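{- Let $n\ge1$, let $\alpha=(\alpha_1,\alpha_2,\dots)$ be complex numbers, let $\lambda$ be a partition with at most $n$ parts, and let $l$ be the length (number of nonzero parts) of $\lambda$. If $i\ge1$ and $n\ge l+i$, then $s_\lambda(z\mid\alpha)=s_\lambda(z\mid\sigma_i\alpha)$, where $\sigma_i\alpha$ is obtained from $\alpha$ by interchanging $\alpha_i$ and $\alpha_{i+1}$.
   Context: $z=(z_1,\dots,z_n)$. For shifts $\gamma$ the factorial Schur function is $s_\lambda(z\mid\gamma)=A_{\lambda+\delta}(z\mid\gamma)/A_\delta(z\mid\gamma)$ with $\delta=(n-1,\dots,0)$, $A_\nu(z\mid\gamma)=\det\big((z_a\mid\gamma)^{\nu_b}\big)_{1\le a,b\le n}$, $(z\mid\gamma)^r=\prod_{k=1}^r(z+\gamma_k)$. -}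

module Defs where

open import Level using (Level; _⊔_) renaming (suc to lsuc)
open import Algebra.Bundles using (CommutativeRing)
open import Data.Nat using (ℕ; zero; suc; _∸_; _≤_; _≟_) renaming (_+_ to _+ℕ_)
open import Relation.Nullary using (yes; no)
open import Data.Fin using (Fin; toℕ; punchIn) renaming (zero to fzero; suc to fsuc)
open import Relation.Nullary using (¬_)
open import Relation.Binary.PropositionalEquality using (_≡_)

-- A field: a commutative ring with 0 ≠ 1 in which every nonzero element has an inverse.
-- (The paper works over ℂ; the standard library has no ℂ and no Field bundle.)
record Field (c ℓ : Level) : Set (lsuc (c ⊔ ℓ)) where
  field
    commutativeRing : CommutativeRing c ℓ
  open CommutativeRing commutativeRing public
  field
    inv     : (x : Carrier) → ¬ (x ≈ 0#) → Carrier
    inverse : ∀ x (p : ¬ (x ≈ 0#)) → x * inv x p ≈ 1#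
    0≉1     : ¬ (0# ≈ 1#)

-- Partitions with at most n parts, stored as weakly decreasing n-tuples padded by zeros.
IsPartition : ∀ {n} → (Fin n → ℕ) → Set
IsPartition {n} lam = ∀ (a : Fin n) (b : Fin n) → toℕ a ≤ toℕ b → lam b ≤ lam a

nonzero? : ℕ → ℕ
nonzero? zero    = 0
nonzero? (suc _) = 1

partLength : ∀ {n} → (Fin n → ℕ) → ℕ
partLength {zero}  lam = 0
partLength {suc n} lam = nonzero? (lam fzero) +ℕ partLength (λ a → lam (fsuc a))

-- δ = (n-1, n-2, …, 0), indexed by Fin n (0-based)
δ : ∀ {n} → Fin n → ℕ
δ {n} b = n ∸ suc (toℕ b)

module _ {c ℓ : Level} (F : Field c ℓ) where
  open Field F

  Σ : ∀ {n} → (Fin n → Carrier) → Carrier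
  Σ {zero}  f = 0#
  Σ {suc n} f = f fzero + Σ (λ j → f (fsuc j))

  sgn : ℕ → Carrier
  sgn zero    = 1#
  sgn (suc k) = - sgn k

  det : ∀ {n} → (Fin n → Fin n → Carrier) → Carrier
  det {zero}  M = 1#
  det {suc n} M = Σ (λ j → sgn (toℕ j) * (M fzero j * det (λ a b → M (fsuc a) (punchIn j b))))

  -- shifts γ = (γ₁, γ₂, …) are represented by γ : ℕ → Carrier with γ k = γ_k for k ≥ 1
  -- (the value γ 0 is never used).
  -- (z ∣ γ)^r = ∏_{k=1}^{r} (z + γ_k)
  fpow : Carrier → (ℕ → Carrier) → ℕ → Carrier
  fpow z γ zero    = 1#
  fpow z γ (suc r) = fpow z γ r * (z + γ (suc r))

  A : ∀ {n} → (Fin n → ℕ) → (Fin n → Carrier) → (ℕ → Carrier) → Carrier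
  A ν z γ = det (λ a b → fpow (z a) γ (ν b))

  plusδ : ∀ {n} → (Fin n → ℕ) → Fin n → ℕ
  plusδ lam b = lam b +ℕ δ b

  s : ∀ {n} → (Fin n → ℕ) → (z : Fin n → Carrier) → (γ : ℕ → Carrier)
      → ¬ (A δ z γ ≈ 0#) → Carrier
  s lam z γ p = A (plusδ lam) z γ * inv (A δ z γ) p

σ : ∀ {a} {C : Set a} → ℕ → (ℕ → C) → (ℕ → C)
σ i γ k with _≟_ k i | _≟_ k (suc i)
... | yes _ | _ = γ (suc i)
... | no _ | yes _ = γ i
... | no _ | no _ = γ k

module Submission where

-- Write e = λ + δ, so that s_λ(z ∣ γ) = A_e(z ∣ γ) / A_δ(z ∣ γ) and the column of
-- A_e indexed by b is the vector of factorial powers (z_a ∣ γ)^{e_b}.  Swapping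
-- γ_i and γ_{i+1} (i ≥ 1) leaves (z ∣ γ)^r unchanged for every r ≠ i, while
--   (z ∣ σ_i γ)^i = (z ∣ γ)^i + (γ_{i+1} − γ_i) (z ∣ γ)^{i-1}.
-- When l + i ≤ n the exponents e are strictly decreasing, and if one of them
-- equals i then the column immediately to its right has exponent i − 1.  Hence
-- passing from γ to σ_i γ either changes no column of A_e at all, or adds a
-- multiple of a column to its left neighbour, which does not change the
-- determinant.  Applying this to λ and to the empty partition shows that
-- numerator and denominator of s_λ are both invariant.

open import Defs
open import Level using (Level)
open import Data.Nat using (ℕ; zero; suc; pred; _≤_; _<_; z≤n; s≤s; s≤s⁻¹; _∸_)
import Data.Nat as ℕ
import Data.Nat.Properties as ℕₚ
open import Data.Fin using (Fin; toℕ; punchIn; punchOut) renaming (zero to fz; suc to fs)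
import Data.Fin.Properties as Finₚ
open import Data.Product using (∃; _,_; _×_; proj₁; proj₂)
open import Data.Empty using (⊥-elim)
open import Data.Sum using (inj₁; inj₂)
open import Function using (_∘_)
open import Relation.Nullary using (¬_; yes; no; contradiction)
open import Relation.Binary.Definitions using (tri<; tri≈; tri>)
open import Relation.Binary.PropositionalEquality
  using (_≡_; _≢_; refl; sym; trans; cong; subst; subst₂; module ≡-Reasoning)

data Adj : ∀ {n} → Fin n → Fin n → Set where
  adj-first : ∀ {n} → Adj {suc (suc n)} fz (fs fz)
  adj-suc   : ∀ {n} {t u : Fin n} → Adj t u → Adj (fs t) (fs u)

adj-toℕ : ∀ {n} {t u : Fin n} → Adj t u → toℕ u ≡ suc (toℕ t)
adj-toℕ adj-first   = refl
adj-toℕ (adj-suc a) = cong suc (adj-toℕ a)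

adj-≢ : ∀ {n} {t u : Fin n} → Adj t u → u ≢ t
adj-≢ a u≡t = ℕₚ.1+n≢n (sym (trans (cong toℕ (sym u≡t)) (adj-toℕ a)))

adj-right : ∀ {n} (t : Fin n) → suc (toℕ t) < n → ∃ λ u → Adj t u
adj-right {suc zero}    fz     (s≤s ())
adj-right {suc (suc n)} fz     _ = fs fz , adj-first
adj-right {suc n}       (fs t) h with adj-right t (s≤s⁻¹ h)
... | u , a = fs u , adj-suc a

-- Deleting a position m outside an adjacent pair keeps the pair adjacent.
-- (Needed because Laplace expansion passes to minors with a column deleted.)
adj-punchIn : ∀ {n} {t u m : Fin (suc n)} → Adj t u → m ≢ t → m ≢ u →
  ∃ λ t′ → ∃ λ u′ → Adj t′ u′ × punchIn m t′ ≡ t × punchIn m u′ ≡ u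
adj-punchIn {m = fz}      adj-first m≢t _ = ⊥-elim (m≢t refl)
adj-punchIn {m = fs fz}   adj-first _ m≢u = ⊥-elim (m≢u refl)
adj-punchIn {suc (suc n)} {m = fs (fs _)} adj-first _ _ = fz , fs fz , adj-first , refl , refl
adj-punchIn {m = fz}      (adj-suc a) _ _ = _ , _ , a , refl , refl
adj-punchIn {suc n} {m = fs m} (adj-suc a) m≢t m≢u
  with adj-punchIn a (λ e → m≢t (cong fs e)) (λ e → m≢u (cong fs e))
... | t′ , u′ , a′ , e₁ , e₂ = fs t′ , fs u′ , adj-suc a′ , cong fs e₁ , cong fs e₂

adj-punchIn-swap : ∀ {n} {t u : Fin (suc n)} → Adj t u →
  ∃ λ s → punchIn t s ≡ u × punchIn u s ≡ t × (∀ b → b ≢ s → punchIn t b ≡ punchIn u b)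
adj-punchIn-swap adj-first = fz , refl , refl , agree
  where
  agree : ∀ b → b ≢ fz → punchIn fz b ≡ punchIn (fs fz) b
  agree fz     b≢0 = ⊥-elim (b≢0 refl)
  agree (fs b) _   = refl
adj-punchIn-swap {suc n} (adj-suc a) with adj-punchIn-swap a
... | s , e₁ , e₂ , agree = fs s , cong fs e₁ , cong fs e₂ , agree′
  where
  agree′ : ∀ b → b ≢ fs s → punchIn (fs _) b ≡ punchIn (fs _) b
  agree′ fz     _   = refl
  agree′ (fs b) b≢s = cong fs (agree b (λ e → b≢s (cong fs e)))

-- Combinatorics of the exponents λ + δ of a partition λ with at most n parts.
module Partitions where
  open import Data.Nat using (_+_)

  partition-tail : ∀ {n} (lam : Fin (suc n) → ℕ) → IsPartition lam →
    IsPartition (λ a → lam (fs a))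
  partition-tail lam P a b a≤b = P (fs a) (fs b) (s≤s a≤b)

  partition-zero : ∀ {n} (lam : Fin n → ℕ) → IsPartition lam →
    ∀ b → partLength lam ≤ toℕ b → lam b ≡ 0
  partition-zero {suc n} lam P b h with lam fz in eq
  partition-zero {suc n} lam P fz     h | zero  = eq
  partition-zero {suc n} lam P (fs b) h | zero  =
    ℕₚ.n≤0⇒n≡0 (subst (lam (fs b) ≤_) eq (P fz (fs b) z≤n))
  partition-zero {suc n} lam P (fs b) h | suc _ =
    partition-zero (λ a → lam (fs a)) (partition-tail lam P) b (s≤s⁻¹ h)

  partLength-≤ : ∀ {n} (lam : Fin n → ℕ) (b : ℕ) →
    (∀ c → b ≤ toℕ c → lam c ≡ 0) → partLength lam ≤ b
  partLength-≤ {zero}  lam b       vanish = z≤n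
  partLength-≤ {suc n} lam zero    vanish rewrite vanish fz z≤n =
    partLength-≤ (λ a → lam (fs a)) zero (λ c _ → vanish (fs c) z≤n)
  partLength-≤ {suc n} lam (suc b) vanish =
    ℕₚ.+-mono-≤ (nonzero?≤1 (lam fz))
      (partLength-≤ (λ a → lam (fs a)) b (λ c h → vanish (fs c) (s≤s h)))
    where
    nonzero?≤1 : ∀ x → nonzero? x ≤ 1
    nonzero?≤1 zero    = z≤n
    nonzero?≤1 (suc _) = s≤s z≤n

  partition-pos : ∀ {n} (lam : Fin n → ℕ) → IsPartition lam →
    ∀ b → toℕ b < partLength lam → 1 ≤ lam b
  partition-pos lam P b h with lam b in eq
  ... | suc _ = s≤s z≤n
  ... | zero  = contradiction (partLength-≤ lam (toℕ b) vanish) (ℕₚ.<⇒≱ h)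
    where
    vanish : ∀ c → toℕ b ≤ toℕ c → lam c ≡ 0
    vanish c b≤c = ℕₚ.n≤0⇒n≡0 (subst (lam c ≤_) eq (P b c b≤c))

  δ-adj : ∀ {n} {t u : Fin n} → Adj t u → δ u ≡ pred (δ t)
  δ-adj {n} {t} a = trans (cong (λ x → n ∸ suc x) (adj-toℕ a))
                          (sym (ℕₚ.pred[m∸n]≡m∸[1+n] n (suc (toℕ t))))

  exponent-decreasing : ∀ {n} (lam : Fin n → ℕ) → IsPartition lam →
    ∀ a b → toℕ a < toℕ b → lam b + δ b < lam a + δ a
  exponent-decreasing lam P a b a<b =
    ℕₚ.+-mono-≤-< (P a b (ℕₚ.<⇒≤ a<b)) (ℕₚ.∸-monoʳ-< (s≤s a<b) (Finₚ.toℕ<n b))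

  exponent-injective : ∀ {n} (lam : Fin n → ℕ) → IsPartition lam →
    ∀ a b → lam a + δ a ≡ lam b + δ b → a ≡ b
  exponent-injective lam P a b eq with ℕₚ.<-cmp (toℕ a) (toℕ b)
  ... | tri< a<b _ _ = contradiction (sym eq) (ℕₚ.<⇒≢ (exponent-decreasing lam P a b a<b))
  ... | tri≈ _ a≡b _ = Finₚ.toℕ-injective a≡b
  ... | tri> _ _ b<a = contradiction eq (ℕₚ.<⇒≢ (exponent-decreasing lam P b a b<a))

  -- When l + i ≤ n, an exponent equal to i ≥ 1 lies in the zero part of λ:
  -- before the length every exponent is at least 1 + (n − l) > i.
  exponent-beyond-length : ∀ {n} (lam : Fin n → ℕ) → IsPartition lam → (i₀ : ℕ) →
    partLength lam + suc i₀ ≤ n →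
    ∀ t → lam t + δ t ≡ suc i₀ → partLength lam ≤ toℕ t
  exponent-beyond-length {n} lam P i₀ l+i≤n t et = ℕₚ.≮⇒≥ λ t<l →
    ℕₚ.<⇒≱ (ℕₚ.+-mono-≤ (partition-pos lam P t t<l) (i≤δt t<l)) (ℕₚ.≤-reflexive et)
    where
    i≤n∸l : suc i₀ ≤ n ∸ partLength lam
    i≤n∸l = ℕₚ.m+n≤o⇒m≤o∸n (suc i₀) (subst (_≤ n) (ℕₚ.+-comm (partLength lam) (suc i₀)) l+i≤n)
    i≤δt : toℕ t < partLength lam → suc i₀ ≤ δ t
    i≤δt t<l = ℕₚ.≤-trans i≤n∸l (ℕₚ.∸-monoʳ-≤ n t<l)

  exponent-step : ∀ {n} (lam : Fin n → ℕ) → IsPartition lam → (i₀ : ℕ) →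
    partLength lam + suc i₀ ≤ n →
    ∀ t → lam t + δ t ≡ suc i₀ → ∃ λ u → Adj t u × lam u + δ u ≡ i₀
  exponent-step {n} lam P i₀ l+i≤n t et = u , a , exponent-u
    where
    open ≡-Reasoning
    l≤t : partLength lam ≤ toℕ t
    l≤t = exponent-beyond-length lam P i₀ l+i≤n t et
    δt≡i : δ t ≡ suc i₀
    δt≡i = trans (cong (_+ δ t) (sym (partition-zero lam P t l≤t))) et
    right : ∃ λ u → Adj t u
    right = adj-right t (ℕₚ.m∸n≢0⇒n<m λ δt≡0 → contradiction (trans (sym δt≡i) δt≡0) λ ())
    u : Fin n
    u = proj₁ right
    a : Adj t u
    a = proj₂ right
    l≤u : partLength lam ≤ toℕ u
    l≤u = ℕₚ.≤-trans l≤t (subst (toℕ t ≤_) (sym (adj-toℕ a)) (ℕₚ.n≤1+n _))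
    exponent-u : lam u + δ u ≡ i₀
    exponent-u = begin
      lam u + δ u ≡⟨ cong (_+ δ u) (partition-zero lam P u l≤u) ⟩
      δ u         ≡⟨ δ-adj a ⟩
      pred (δ t)  ≡⟨ cong pred δt≡i ⟩
      i₀          ∎

σ-at-i : ∀ {a} {C : Set a} (i : ℕ) (γ : ℕ → C) → σ i γ i ≡ γ (suc i)
σ-at-i i γ with i ℕ.≟ i
... | yes _   = refl
... | no i≢i = ⊥-elim (i≢i refl)

σ-at-suc-i : ∀ {a} {C : Set a} (i : ℕ) (γ : ℕ → C) → σ i γ (suc i) ≡ γ i
σ-at-suc-i i γ with suc i ℕ.≟ i | suc i ℕ.≟ suc i
... | yes 1+i≡i | _       = ⊥-elim (ℕₚ.1+n≢n 1+i≡i)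
... | no _      | yes _   = refl
... | no _      | no ne   = ⊥-elim (ne refl)

σ-elsewhere : ∀ {a} {C : Set a} (i k : ℕ) (γ : ℕ → C) → k ≢ i → k ≢ suc i → σ i γ k ≡ γ k
σ-elsewhere i k γ k≢i k≢1+i with k ℕ.≟ i | k ℕ.≟ suc i
... | yes k≡i | _         = ⊥-elim (k≢i k≡i)
... | no _    | yes k≡1+i = ⊥-elim (k≢1+i k≡1+i)
... | no _    | no _      = refl

-- Laplace-expanded determinants; only the commutative-ring structure of F is used.
module Determinants {c ℓ : Level} (F : Field c ℓ) where
  open Field F renaming (refl to ≈-refl; sym to ≈-sym; trans to ≈-trans)
  open import Relation.Binary.Reasoning.Setoid setoid
  open import Algebra.Solver.Ring.NaturalCoefficients.Default commutativeSemiring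
  open import Data.Vec.Functional using (updateAt)
  open import Data.Vec.Functional.Properties using (updateAt-updates; updateAt-minimal)

  Matrix : ℕ → Set c
  Matrix n = Fin n → Fin n → Carrier

  minor : ∀ {n} → Matrix (suc n) → Fin (suc n) → Matrix n
  minor M j a b = M (fs a) (punchIn j b)

  expansionTerm : ∀ {n} → Matrix (suc n) → Fin (suc n) → Carrier
  expansionTerm M j = sgn F (toℕ j) * (M fz j * det F (minor M j))

  Σ-cong : ∀ {n} {f g : Fin n → Carrier} → (∀ j → f j ≈ g j) → Σ F f ≈ Σ F g
  Σ-cong {zero}  _ = ≈-refl
  Σ-cong {suc n} h = +-cong (h fz) (Σ-cong (λ j → h (fs j)))

  Σ-zero : ∀ {n} {f : Fin n → Carrier} → (∀ j → f j ≈ 0#) → Σ F f ≈ 0#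
  Σ-zero {zero}  _ = ≈-refl
  Σ-zero {suc n} h = ≈-trans (+-cong (h fz) (Σ-zero (λ j → h (fs j)))) (+-identityʳ 0#)

  Σ-linear : ∀ {n} (k : Carrier) {f g h : Fin n → Carrier} →
    (∀ j → f j ≈ g j + k * h j) → Σ F f ≈ Σ F g + k * Σ F h
  Σ-linear {zero}  k _  = ≈-sym (≈-trans (+-congˡ (zeroʳ k)) (+-identityʳ 0#))
  Σ-linear {suc n} k hf =
    ≈-trans (+-cong (hf fz) (Σ-linear k (λ j → hf (fs j)))) (regroup _ _ k _ _)
    where
    regroup : ∀ g h k G H → (g + k * h) + (G + k * H) ≈ (g + G) + k * (h + H)
    regroup = solve 5 (λ g h k G H → ((g :+ k :* h) :+ (G :+ k :* H)) := ((g :+ G) :+ k :* (h :+ H))) ≈-refl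

  Σ-vanish : ∀ {n} {f : Fin n → Carrier} {t u : Fin n} → Adj t u →
    (∀ m → m ≢ t → m ≢ u → f m ≈ 0#) → f t + f u ≈ 0# → Σ F f ≈ 0#
  Σ-vanish {f = f} adj-first rest pair = begin
    f fz + (f (fs fz) + _) ≈⟨ ≈-sym (+-assoc _ _ _) ⟩
    (f fz + f (fs fz)) + _ ≈⟨ +-cong pair (Σ-zero (λ j → rest (fs (fs j)) (λ ()) (λ ()))) ⟩
    0# + 0#                ≈⟨ +-identityʳ 0# ⟩
    0#                     ∎
  Σ-vanish (adj-suc a) rest pair =
    ≈-trans (+-cong (rest fz (λ ()) (λ ()))
                  (Σ-vanish a (λ m m≢t m≢u → rest (fs m) (m≢t ∘ Finₚ.suc-injective) (m≢u ∘ Finₚ.suc-injective)) pair))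
          (+-identityʳ 0#)

  det-cong : ∀ {n} {M N : Matrix n} → (∀ a b → M a b ≈ N a b) → det F M ≈ det F N
  det-cong {zero}  _ = ≈-refl
  det-cong {suc n} h =
    Σ-cong (λ j → *-congˡ {sgn F (toℕ j)} (*-cong (h fz j) (det-cong (λ a b → h (fs a) (punchIn j b)))))

  -- s x + (−s) x = 0: the two expansion terms of an adjacent pair carry opposite signs.
  cancel : ∀ s x → s * x + (- s) * x ≈ 0#
  cancel s x = begin
    s * x + (- s) * x ≈⟨ ≈-sym (distribʳ x s (- s)) ⟩
    (s + - s) * x     ≈⟨ *-congʳ (-‿inverseʳ s) ⟩
    0# * x            ≈⟨ zeroˡ x ⟩
    0#                ∎

  sgn-adj : ∀ {n} {t u : Fin n} → Adj t u → sgn F (toℕ u) ≡ - sgn F (toℕ t)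
  sgn-adj a = cong (sgn F) (adj-toℕ a)

  det-adjacent-equal : ∀ {n} (M : Matrix n) {t u : Fin n} → Adj t u →
    (∀ a → M a t ≈ M a u) → det F M ≈ 0#
  det-adjacent-equal {suc n} M {t} {u} adj tu = Σ-vanish adj outside pair
    where
    outside : ∀ m → m ≢ t → m ≢ u → expansionTerm M m ≈ 0#
    outside m m≢t m≢u with adj-punchIn adj m≢t m≢u
    ... | t′ , u′ , adj′ , e₁ , e₂ = begin
      sgn F (toℕ m) * (M fz m * det F (minor M m)) ≈⟨ *-congˡ (*-congˡ minor-zero) ⟩
      sgn F (toℕ m) * (M fz m * 0#)                ≈⟨ *-congˡ (zeroʳ _) ⟩
      sgn F (toℕ m) * 0#                           ≈⟨ zeroʳ _ ⟩
      0#                                           ∎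
      where
      minor-zero : det F (minor M m) ≈ 0#
      minor-zero = det-adjacent-equal (minor M m) adj′
        (λ a → subst₂ (λ x y → M (fs a) x ≈ M (fs a) y) (sym e₁) (sym e₂) (tu (fs a)))
    minors-equal : det F (minor M u) ≈ det F (minor M t)
    minors-equal with adj-punchIn-swap adj
    ... | s , ts≡u , us≡t , agree = det-cong entry
      where
      entry : ∀ a b → M (fs a) (punchIn u b) ≈ M (fs a) (punchIn t b)
      entry a b with b Finₚ.≟ s
      ... | yes refl = subst₂ (λ x y → M (fs a) x ≈ M (fs a) y) (sym us≡t) (sym ts≡u) (tu (fs a))
      ... | no b≢s   = reflexive (cong (M (fs a)) (sym (agree b b≢s)))
    pair : expansionTerm M t + expansionTerm M u ≈ 0#
    pair rewrite sgn-adj adj = ≈-trans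
      (+-congˡ (*-congˡ (*-cong (≈-sym (tu fz)) minors-equal)))
      (cancel (sgn F (toℕ t)) _)

  -- The two shapes of a Laplace term of det N = det M + k det Q.  In the changed
  -- column j = t the linearity sits in the first-row entry, elsewhere in the minor.
  term-linear-entry : ∀ {n} (M N Q : Matrix (suc n)) (j : Fin (suc n)) (k : Carrier) →
    N fz j ≈ M fz j + k * Q fz j → det F (minor N j) ≈ det F (minor M j) →
    det F (minor Q j) ≈ det F (minor M j) →
    expansionTerm N j ≈ expansionTerm M j + k * expansionTerm Q j
  term-linear-entry M N Q j k entry minorN minorQ = begin
    sg * (N fz j * det F (minor N j))
      ≈⟨ *-congˡ (*-cong entry minorN) ⟩
    sg * ((M fz j + k * Q fz j) * det F (minor M j))
      ≈⟨ expand sg (M fz j) k (Q fz j) (det F (minor M j)) ⟩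
    sg * (M fz j * det F (minor M j)) + k * (sg * (Q fz j * det F (minor M j)))
      ≈⟨ +-congˡ (*-congˡ (*-congˡ (*-congˡ (≈-sym minorQ)))) ⟩
    sg * (M fz j * det F (minor M j)) + k * (sg * (Q fz j * det F (minor Q j))) ∎
    where
    sg : Carrier
    sg = sgn F (toℕ j)
    expand : ∀ s x k y d → s * ((x + k * y) * d) ≈ s * (x * d) + k * (s * (y * d))
    expand = solve 5 (λ s x k y d → (s :* ((x :+ k :* y) :* d)) := (s :* (x :* d) :+ k :* (s :* (y :* d)))) ≈-refl

  term-linear-minor : ∀ {n} (M N Q : Matrix (suc n)) (j : Fin (suc n)) (k : Carrier) →
    N fz j ≈ M fz j → Q fz j ≈ M fz j →
    det F (minor N j) ≈ det F (minor M j) + k * det F (minor Q j) →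
    expansionTerm N j ≈ expansionTerm M j + k * expansionTerm Q j
  term-linear-minor M N Q j k entryN entryQ minorN = begin
    sg * (N fz j * det F (minor N j))
      ≈⟨ *-congˡ (*-cong entryN minorN) ⟩
    sg * (M fz j * (det F (minor M j) + k * det F (minor Q j)))
      ≈⟨ expand sg (M fz j) (det F (minor M j)) k (det F (minor Q j)) ⟩
    sg * (M fz j * det F (minor M j)) + k * (sg * (M fz j * det F (minor Q j)))
      ≈⟨ +-congˡ (*-congˡ (*-congˡ (*-congʳ (≈-sym entryQ)))) ⟩
    sg * (M fz j * det F (minor M j)) + k * (sg * (Q fz j * det F (minor Q j))) ∎
    where
    sg : Carrier
    sg = sgn F (toℕ j)
    expand : ∀ s x d k e → s * (x * (d + k * e)) ≈ s * (x * d) + k * (s * (x * e))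
    expand = solve 5 (λ s x d k e → (s :* (x :* (d :+ k :* e))) := (s :* (x :* d) :+ k :* (s :* (x :* e)))) ≈-refl

  det-linear : ∀ {n} (M N Q : Matrix n) (t : Fin n) (k : Carrier) →
    (∀ a b → b ≢ t → N a b ≈ M a b) → (∀ a b → b ≢ t → Q a b ≈ M a b) →
    (∀ a → N a t ≈ M a t + k * Q a t) → det F N ≈ det F M + k * det F Q
  det-linear {suc n} M N Q t k N≈M Q≈M col = Σ-linear k term
    where
    term : ∀ j → expansionTerm N j ≈ expansionTerm M j + k * expansionTerm Q j
    term j with j Finₚ.≟ t
    ... | yes refl = term-linear-entry M N Q j k (col fz)
      (det-cong (λ a b → N≈M (fs a) (punchIn j b) (Finₚ.punchInᵢ≢i j b)))
      (det-cong (λ a b → Q≈M (fs a) (punchIn j b) (Finₚ.punchInᵢ≢i j b)))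
    ... | no j≢t = term-linear-minor M N Q j k (N≈M fz j j≢t) (Q≈M fz j j≢t) minor-linear
      where
      t′ : Fin n
      t′ = punchOut j≢t
      jt′≡t : punchIn j t′ ≡ t
      jt′≡t = Finₚ.punchIn-punchOut j≢t
      off : ∀ b → b ≢ t′ → punchIn j b ≢ t
      off b b≢t′ e = b≢t′ (Finₚ.punchIn-injective j b t′ (trans e (sym jt′≡t)))
      minor-linear : det F (minor N j) ≈ det F (minor M j) + k * det F (minor Q j)
      minor-linear = det-linear (minor M j) (minor N j) (minor Q j) t′ k
        (λ a b h → N≈M (fs a) (punchIn j b) (off b h))
        (λ a b h → Q≈M (fs a) (punchIn j b) (off b h))
        (λ a → subst (λ x → N (fs a) x ≈ M (fs a) x + k * Q (fs a) x) (sym jt′≡t) (col (fs a)))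

  det-column-operation : ∀ {n} (M N : Matrix n) {t u : Fin n} (k : Carrier) → Adj t u →
    (∀ a b → b ≢ t → N a b ≈ M a b) → (∀ a → N a t ≈ M a t + k * M a u) →
    det F N ≈ det F M
  det-column-operation M N {t} {u} k adj N≈M col = begin
    det F N              ≈⟨ det-linear M N Q t k N≈M Q≈M col′ ⟩
    det F M + k * det F Q ≈⟨ +-congˡ (*-congˡ Q-singular) ⟩
    det F M + k * 0#      ≈⟨ +-congˡ (zeroʳ k) ⟩
    det F M + 0#          ≈⟨ +-identityʳ _ ⟩
    det F M               ∎
    where
    Q : Matrix _
    Q a = updateAt (M a) t (λ _ → M a u)
    Qt≡Mu : ∀ a → Q a t ≡ M a u
    Qt≡Mu a = updateAt-updates t (M a)
    Q≈M : ∀ a b → b ≢ t → Q a b ≈ M a b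
    Q≈M a b b≢t = reflexive (updateAt-minimal b t (M a) b≢t)
    col′ : ∀ a → N a t ≈ M a t + k * Q a t
    col′ a = ≈-trans (col a) (+-congˡ (*-congˡ (reflexive (sym (Qt≡Mu a)))))
    Q-singular : det F Q ≈ 0#
    Q-singular = det-adjacent-equal Q adj
      (λ a → reflexive (trans (Qt≡Mu a) (sym (updateAt-minimal u t (M a) (adj-≢ adj)))))

-- Factorial powers under σ_i and the invariance of A_e and of s_λ.
module FactorialSchur {c ℓ : Level} (F : Field c ℓ) where
  open Field F renaming (refl to ≈-refl; sym to ≈-sym; trans to ≈-trans)
  open import Relation.Binary.Reasoning.Setoid setoid
  open import Algebra.Solver.Ring.NaturalCoefficients.Default commutativeSemiring
  open Determinants F using (Matrix; det-cong; det-column-operation)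

  -- (z ∣ σ_i γ)^r = (z ∣ γ)^r for r < i: only the shifts γ_1, …, γ_r enter.
  fpow-below : ∀ z (γ : ℕ → Carrier) i r → r < i → fpow F z (σ i γ) r ≈ fpow F z γ r
  fpow-below z γ i zero    _   = ≈-refl
  fpow-below z γ i (suc r) r<i = *-cong (fpow-below z γ i r (ℕₚ.<-trans (ℕₚ.n<1+n r) r<i))
    (+-congˡ (reflexive (σ-elsewhere i (suc r) γ (ℕₚ.<⇒≢ r<i) (ℕₚ.<⇒≢ (ℕₚ.<-trans r<i (ℕₚ.n<1+n i))))))

  -- (z ∣ σ_i γ)^r = (z ∣ γ)^r for r > i ≥ 1: both γ_i and γ_{i+1} enter, symmetrically.
  fpow-above : ∀ z (γ : ℕ → Carrier) i₀ r → suc i₀ < r → fpow F z (σ (suc i₀) γ) r ≈ fpow F z γ r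
  fpow-above z γ i₀ (suc r) (s≤s i<r) with ℕₚ.m≤n⇒m<n∨m≡n i<r
  ... | inj₁ i+1<r = *-cong (fpow-above z γ i₀ r i+1<r) (+-congˡ (reflexive
          (σ-elsewhere (suc i₀) (suc r) γ (ℕₚ.<⇒≢ (ℕₚ.<-trans i+1<r (ℕₚ.n<1+n r)) ∘ sym)
                                          (ℕₚ.<⇒≢ i+1<r ∘ sym ∘ ℕₚ.suc-injective))))
  ... | inj₂ refl = begin
    (fpow F z σγ i₀ * (z + σγ (suc i₀))) * (z + σγ (suc (suc i₀)))
      ≈⟨ *-cong (*-cong (fpow-below z γ (suc i₀) i₀ (ℕₚ.n<1+n i₀)) (+-congˡ (reflexive (σ-at-i (suc i₀) γ))))
                (+-congˡ (reflexive (σ-at-suc-i (suc i₀) γ))) ⟩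
    (fpow F z γ i₀ * (z + γ (suc (suc i₀)))) * (z + γ (suc i₀))
      ≈⟨ swap _ _ _ ⟩
    (fpow F z γ i₀ * (z + γ (suc i₀))) * (z + γ (suc (suc i₀))) ∎
    where
    σγ : ℕ → Carrier
    σγ = σ (suc i₀) γ
    swap : ∀ q a b → (q * a) * b ≈ (q * b) * a
    swap = solve 3 (λ q a b → ((q :* a) :* b) := ((q :* b) :* a)) ≈-refl

  fpow-off : ∀ z (γ : ℕ → Carrier) i₀ r → r ≢ suc i₀ → fpow F z (σ (suc i₀) γ) r ≈ fpow F z γ r
  fpow-off z γ i₀ r r≢i with ℕₚ.<-cmp r (suc i₀)
  ... | tri< r<i _ _ = fpow-below z γ (suc i₀) r r<i
  ... | tri≈ _ r≡i _ = ⊥-elim (r≢i r≡i)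
  ... | tri> _ _ i<r = fpow-above z γ i₀ r i<r

  fpow-at : ∀ z (γ : ℕ → Carrier) i₀ →
    fpow F z (σ (suc i₀) γ) (suc i₀) ≈ fpow F z γ (suc i₀) + (γ (suc (suc i₀)) - γ (suc i₀)) * fpow F z γ i₀
  fpow-at z γ i₀ = begin
    fpow F z (σ (suc i₀) γ) i₀ * (z + σ (suc i₀) γ (suc i₀))
      ≈⟨ *-cong (fpow-below z γ (suc i₀) i₀ (ℕₚ.n<1+n i₀)) (+-congˡ (reflexive (σ-at-i (suc i₀) γ))) ⟩
    q * (z + b)
      ≈⟨ ≈-sym (+-identityʳ _) ⟩
    q * (z + b) + 0#
      ≈⟨ +-congˡ (≈-sym (zeroˡ q)) ⟩
    q * (z + b) + 0# * q
      ≈⟨ +-congˡ (*-congʳ (≈-sym (-‿inverseʳ a))) ⟩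
    q * (z + b) + (a - a) * q
      ≈⟨ exchange q z a b (- a) ⟩
    q * (z + a) + (b - a) * q ∎
    where
    q a b : Carrier
    q = fpow F z γ i₀
    a = γ (suc i₀)
    b = γ (suc (suc i₀))
    exchange : ∀ q z a b na → q * (z + b) + (a + na) * q ≈ q * (z + a) + (b + na) * q
    exchange = solve 5 (λ q z a b na →
      (q :* (z :+ b) :+ (a :+ na) :* q) := (q :* (z :+ a) :+ (b :+ na) :* q)) ≈-refl

  -- Suppose the exponents e are pairwise distinct and an exponent equal to i ≥ 1
  -- is always followed, in the next column, by the exponent i − 1.  Then
  -- A_e(z ∣ σ_i γ) = A_e(z ∣ γ): either no column changes, or the column with
  -- exponent i gains a multiple of its right neighbour.
  A-σ-invariant : ∀ {n} (e : Fin n → ℕ) (z : Fin n → Carrier) (γ : ℕ → Carrier) (i₀ : ℕ) →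
    (∀ a b → e a ≡ e b → a ≡ b) →
    (∀ t → e t ≡ suc i₀ → ∃ λ u → Adj t u × e u ≡ i₀) →
    A F e z (σ (suc i₀) γ) ≈ A F e z γ
  A-σ-invariant e z γ i₀ injective step with Finₚ.any? (λ t → e t ℕ.≟ suc i₀)
  ... | no none = det-cong (λ a b → fpow-off (z a) γ i₀ (e b) (λ eb → none (b , eb)))
  ... | yes (t , et) with step t et
  ...   | u , adj , eu = det-column-operation M N k adj unchanged column-t
    where
    M N : Matrix _
    M a b = fpow F (z a) γ (e b)
    N a b = fpow F (z a) (σ (suc i₀) γ) (e b)
    k : Carrier
    k = γ (suc (suc i₀)) - γ (suc i₀)
    unchanged : ∀ a b → b ≢ t → N a b ≈ M a b
    unchanged a b b≢t = fpow-off (z a) γ i₀ (e b) (λ eb → b≢t (injective b t (trans eb (sym et))))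
    column-t : ∀ a → N a t ≈ M a t + k * M a u
    column-t a rewrite et | eu = fpow-at (z a) γ i₀

  A-partition-σ-invariant : ∀ {n} (lam : Fin n → ℕ) → IsPartition lam → (i₀ : ℕ) →
    partLength lam ℕ.+ suc i₀ ≤ n → (z : Fin n → Carrier) (γ : ℕ → Carrier) →
    A F (plusδ F lam) z (σ (suc i₀) γ) ≈ A F (plusδ F lam) z γ
  A-partition-σ-invariant lam P i₀ l+i≤n z γ = A-σ-invariant (plusδ F lam) z γ i₀
    (Partitions.exponent-injective lam P) (Partitions.exponent-step lam P i₀ l+i≤n)

  inv-cong : ∀ {x y} (p : ¬ x ≈ 0#) (q : ¬ y ≈ 0#) → x ≈ y → inv x p ≈ inv y q
  inv-cong {x} {y} p q x≈y = begin
    inv x p                 ≈⟨ ≈-sym (*-identityʳ _) ⟩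
    inv x p * 1#            ≈⟨ *-congˡ (≈-sym (inverse y q)) ⟩
    inv x p * (y * inv y q) ≈⟨ *-congˡ (*-congʳ (≈-sym x≈y)) ⟩
    inv x p * (x * inv y q) ≈⟨ ≈-sym (*-assoc _ _ _) ⟩
    (inv x p * x) * inv y q ≈⟨ *-congʳ (*-comm _ _) ⟩
    (x * inv x p) * inv y q ≈⟨ *-congʳ (inverse x p) ⟩
    1# * inv y q            ≈⟨ *-identityˡ _ ⟩
    inv y q                 ∎

-- Natural-number addition, as it appears in the statement (the modules above
-- use the ring's addition under the same name).
open import Data.Nat using (_+_)

mainTheorem11 : {c ℓ : Level} (F : Field c ℓ) (n : ℕ) → 1 ≤ n →
    (α : ℕ → Field.Carrier F) (lam : Fin n → ℕ) → IsPartition lam →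
    (i : ℕ) → 1 ≤ i → partLength lam + i ≤ n →
    (z : Fin n → Field.Carrier F) →
    (p : ¬ Field._≈_ F (A F δ z α) (Field.0# F)) →
    (q : ¬ Field._≈_ F (A F δ z (σ i α)) (Field.0# F)) →
    Field._≈_ F (s F lam z α p) (s F lam z (σ i α) q)
mainTheorem11 F n _ α lam P (suc i₀) _ l+i≤n z p q =
  *-cong (≈-sym numerator) (inv-cong p q (≈-sym denominator))
  where
  open Field F using (*-cong) renaming (sym to ≈-sym)
  open FactorialSchur F using (A-partition-σ-invariant; inv-cong)
  numerator : Field._≈_ F (A F (plusδ F lam) z (σ (suc i₀) α)) (A F (plusδ F lam) z α)
  numerator = A-partition-σ-invariant lam P i₀ l+i≤n z α
  -- δ = 0 + δ is the exponent vector of the empty partition, whose length is 0.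
  empty-bound : partLength {n} (λ _ → 0) + suc i₀ ≤ n
  empty-bound = ℕₚ.≤-trans (ℕₚ.+-monoˡ-≤ (suc i₀)
    (ℕₚ.≤-trans (Partitions.partLength-≤ {n} (λ _ → 0) 0 (λ _ _ → refl)) z≤n)) l+i≤n
  denominator : Field._≈_ F (A F δ z (σ (suc i₀) α)) (A F δ z α)
  denominator = A-partition-σ-invariant (λ _ → 0) (λ _ _ _ → z≤n) i₀ empty-bound z α
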